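{- If a sequent $\Gamma\Rightarrow\Delta$ is derivable in QGPM, then $\Gamma\Rightarrow\Delta$ is valid in every first-order quasi-boolean model.
   Context: Language: first-order, predicate symbols and constants, no function symbols; connectives $\top,\wedge,\vee,\rightarrow,\forall,\exists$; disjoint sets of free variables $a,b,\dots$ (only free) and bound variables $x,y,\dots$ (only bound). $\phi[u/x]$ is substitution; $\phi(a)$ is $\phi(x)$ with $a$ for $x$. QGPM: sequents $\Gamma\Rightarrow\Delta$ ($\Gamma,\Delta$ finite sets); axioms $\phi\Rightarrow\phi$, $\Rightarrow\top$; rules ($\wedge$L) $\Gamma,\phi,\psi\Rightarrow\Delta$ / $\Gamma,\phi\wedge\psi\Rightarrow\Delta$; ($\wedge$R) $\Gamma\Rightarrow\Delta,\phi$ and $\Gamma\Rightarrow\Delta,\psi$ / $\Gamma\Rightarrow\Delta,\phi\wedge\psi$; ($\vee$L) $\Gamma,\phi\Rightarrow\Delta$ and $\Gamma,\psi\Rightarrow\Delta$ / $\Gamma,\phi\vee\psi\Rightarrow\Delta$; ($\vee$R) $\Gamma\Rightarrow\Delta,\phi,\psi$ / $\Gamma\Rightarrow\Delta,\phi\vee\psi$; ($\rightarrow$L) $\Gamma,\psi\Rightarrow\Delta$ and $\Gamma\Rightarrow\Delta,\phi$ / $\Gamma,\phi\rightarrow\psi\Rightarrow\Delta$; ($\rightarrow$Rp) $\Gamma\Rightarrow\psi,\Delta$ / $\Gamma\Rightarrow\phi\rightarrow\psi,\Delta$; ($\forall$R) $\Gamma\Rightarrow\Delta,\phi(a)$ /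 $\Gamma\Rightarrow\Delta,\forall x\phi(x)$ with $a$ not occurring in the conclusion; ($\forall$L) $\Gamma,\phi[u/x]\Rightarrow\Delta$ / $\Gamma,\forall x\phi(x)\Rightarrow\Delta$, $u$ a constant or free variable; ($\exists$R) $\Gamma\Rightarrow\Delta,\phi[u/x]$ / $\Gamma\Rightarrow\Delta,\exists x\phi(x)$; ($\exists$L) $\Gamma,\phi(a)\Rightarrow\Delta$ / $\Gamma,\exists x\phi(x)\Rightarrow\Delta$ with $a$ not in the conclusion; (Weakening) $\Gamma\Rightarrow\Delta$ / $\Gamma,\Gamma_1\Rightarrow\Delta,\Delta_1$; (Cut) $\Gamma\Rightarrow\Delta,\phi$ and $\phi,\Gamma_1\Rightarrow\Delta_1$ / $\Gamma,\Gamma_1\Rightarrow\Delta,\Delta_1$. A first-order quasi-boolean model is $\mathcal M=(M,v)$ with $M\neq\varnothing$, an interpretation $\tilde c\in M$ of each constant $c$, and a new name $\bar u$ added to the language for every $u\in M$; $v$ assigns $0$ or $1$ to every closed atomic formula and every closed implication $\phi\rightarrow\psi$ (of the extended language). Forcing: $\mathcal M\vDash\phi$ iff $v(\phi)=1$ for closed atomic $\phi$ and implications; $\mathcal M\vDash\top$; $\wedge,\vee$ are evaluated classically; $\mathcal M\vDash\forall x\phi(x)$ iff $\mathcal M\vDash\phi[\bar u/x]$ for all $u\in M$; $\mathcal M\vDash\exists x\phi(x)$ iff $\mathcal M\vDash\phi[\bar u/x]$ for some $u\in M$. The valuation must be quasi-boolean: for every implication, (1) if $\mathcal M\vDash\psi$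 then $\mathcal M\vDash\phi\rightarrow\psi$; (2) if $\mathcal M\vDash\phi\rightarrow\psi$ then $\mathcal M\not\vDash\phi$ or $\mathcal M\vDash\psi$. A sequent $\Gamma(\vec a)\Rightarrow\Delta(\vec a)$ with free variables $\vec a$ is valid in $\mathcal M$ iff for all $\vec u\in M$, $\mathcal M\vDash\bigwedge\Gamma[\vec{\bar u}/\vec a]$ implies $\mathcal M\vDash\bigvee\Delta[\vec{\bar u}/\vec a]$ (the empty disjunction is false). -}

module Defs where

open import Data.Nat using (ℕ; zero; suc)
open import Data.Fin using (Fin; zero; suc)
open import Data.Vec using (Vec; []; _∷_)
open import Data.List using (List; []; _∷_; _++_; [_])
open import Data.List.Relation.Unary.All using (All)
open import Data.List.Relation.Unary.Any using (Any)
open import Data.List.Relation.Binary.Subset.Propositional using (_⊆_)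
open import Data.Sum using (_⊎_; inj₁; inj₂)
open import Data.Product using (_×_; Σ)
open import Data.Unit using (⊤)
open import Data.Empty using (⊥)
open import Data.Bool using (Bool; true)
open import Relation.Nullary using (¬_)
open import Relation.Binary.PropositionalEquality using (_≡_)

record Signature : Set₁ where
  field
    Pred  : Set
    arity : Pred → ℕ
    Const : Set

module Logic (S : Signature) where
  open Signature S

  -- Terms over a type V of "parameters" (free variables / constants,
  -- or names of model elements), with n bound variables in scope.
  -- Bound variables are de Bruijn indices (innermost binder = zero),
  -- so formulas are well-formed by construction: bound variables
  -- only ever occur bound.
  data Term (V : Set) (n : ℕ) : Set where
    bvar : Fin n → Term V n
    par  : V → Term V n

  data Formula (V : Set) (n : ℕ) : Set where
    atom : (P : Pred) → Vec (Term V n) (arity P) → Formula V n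
    `⊤   : Formula V n
    _`∧_ : Formula V n → Formula V n → Formula V n
    _`∨_ : Formula V n → Formula V n → Formula V n
    _`→_ : Formula V n → Formula V n → Formula V n
    `∀   : Formula V (suc n) → Formula V n
    `∃   : Formula V (suc n) → Formula V n

  wkT : ∀ {V n} → Term V n → Term V (suc n)
  wkT (bvar i) = bvar (suc i)
  wkT (par v)  = par v

  liftσ : ∀ {V m n} → (Fin m → Term V n) → Fin (suc m) → Term V (suc n)
  liftσ σ zero    = bvar zero
  liftσ σ (suc i) = wkT (σ i)

  substT : ∀ {V m n} → (Fin m → Term V n) → Term V m → Term V n
  substT σ (bvar i) = σ i
  substT σ (par v)  = par v

  substTs : ∀ {V m n k} → (Fin m → Term V n) → Vec (Term V m) k → Vec (Term V n) k
  substTs σ []       = []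
  substTs σ (t ∷ ts) = substT σ t ∷ substTs σ ts

  substF : ∀ {V m n} → (Fin m → Term V n) → Formula V m → Formula V n
  substF σ (atom P ts) = atom P (substTs σ ts)
  substF σ `⊤          = `⊤
  substF σ (φ `∧ ψ)    = substF σ φ `∧ substF σ ψ
  substF σ (φ `∨ ψ)    = substF σ φ `∨ substF σ ψ
  substF σ (φ `→ ψ)    = substF σ φ `→ substF σ ψ
  substF σ (`∀ φ)      = `∀ (substF (liftσ σ) φ)
  substF σ (`∃ φ)      = `∃ (substF (liftσ σ) φ)

  inst : ∀ {V} → Formula V 1 → V → Formula V 0
  inst φ u = substF (λ _ → par u) φ

  mapT : ∀ {V W n} → (V → W) → Term V n → Term W n
  mapT f (bvar i) = bvar i
  mapT f (par v)  = par (f v)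

  mapTs : ∀ {V W n k} → (V → W) → Vec (Term V n) k → Vec (Term W n) k
  mapTs f []       = []
  mapTs f (t ∷ ts) = mapT f t ∷ mapTs f ts

  mapF : ∀ {V W n} → (V → W) → Formula V n → Formula W n
  mapF f (atom P ts) = atom P (mapTs f ts)
  mapF f `⊤          = `⊤
  mapF f (φ `∧ ψ)    = mapF f φ `∧ mapF f ψ
  mapF f (φ `∨ ψ)    = mapF f φ `∨ mapF f ψ
  mapF f (φ `→ ψ)    = mapF f φ `→ mapF f ψ
  mapF f (`∀ φ)      = `∀ (mapF f φ)
  mapF f (`∃ φ)      = `∃ (mapF f φ)

  Par : Set
  Par = ℕ ⊎ Const

  fv : ℕ → Par
  fv = inj₁

  Fm : Set
  Fm = Formula Par 0

  OccT : ∀ {n} → ℕ → Term Par n → Set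
  OccT a (bvar i) = ⊥
  OccT a (par u)  = u ≡ fv a

  OccF : ∀ {n} → ℕ → Formula Par n → Set
  OccF a (atom P ts) = Any (OccT a) (Data.Vec.toList ts)
    where import Data.Vec
  OccF a `⊤          = ⊥
  OccF a (φ `∧ ψ)    = OccF a φ ⊎ OccF a ψ
  OccF a (φ `∨ ψ)    = OccF a φ ⊎ OccF a ψ
  OccF a (φ `→ ψ)    = OccF a φ ⊎ OccF a ψ
  OccF a (`∀ φ)      = OccF a φ
  OccF a (`∃ φ)      = OccF a φ

  FreshIn : ℕ → List Fm → List Fm → Set
  FreshIn a Γ Δ = ¬ Any (OccF a) Γ × ¬ Any (OccF a) Δ

  -- Sequents are pairs of finite SETS; we represent them by lists and
  -- identify lists with the same elements via the rule `set`.
  _≈ₛ_ : List Fm → List Fm → Set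
  Γ ≈ₛ Γ′ = (Γ ⊆ Γ′) × (Γ′ ⊆ Γ)

  data _⊢_ : List Fm → List Fm → Set where
    ax   : ∀ φ → [ φ ] ⊢ [ φ ]
    ax⊤  : [] ⊢ [ `⊤ ]
    ∧L   : ∀ {Γ Δ φ ψ} → (φ ∷ ψ ∷ Γ) ⊢ Δ → ((φ `∧ ψ) ∷ Γ) ⊢ Δ
    ∧R   : ∀ {Γ Δ φ ψ} → Γ ⊢ (φ ∷ Δ) → Γ ⊢ (ψ ∷ Δ) → Γ ⊢ ((φ `∧ ψ) ∷ Δ)
    ∨L   : ∀ {Γ Δ φ ψ} → (φ ∷ Γ) ⊢ Δ → (ψ ∷ Γ) ⊢ Δ → ((φ `∨ ψ) ∷ Γ) ⊢ Δ
    ∨R   : ∀ {Γ Δ φ ψ} → Γ ⊢ (φ ∷ ψ ∷ Δ) → Γ ⊢ ((φ `∨ ψ) ∷ Δ)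
    →L   : ∀ {Γ Δ φ ψ} → (ψ ∷ Γ) ⊢ Δ → Γ ⊢ (φ ∷ Δ) → ((φ `→ ψ) ∷ Γ) ⊢ Δ
    →Rp  : ∀ {Γ Δ φ ψ} → Γ ⊢ (ψ ∷ Δ) → Γ ⊢ ((φ `→ ψ) ∷ Δ)
    ∀R   : ∀ {Γ Δ} (φ : Formula Par 1) (a : ℕ) →
           FreshIn a Γ (`∀ φ ∷ Δ) →
           Γ ⊢ (inst φ (fv a) ∷ Δ) → Γ ⊢ (`∀ φ ∷ Δ)
    ∀L   : ∀ {Γ Δ} (φ : Formula Par 1) (u : Par) →
           (inst φ u ∷ Γ) ⊢ Δ → (`∀ φ ∷ Γ) ⊢ Δ
    ∃R   : ∀ {Γ Δ} (φ : Formula Par 1) (u : Par) →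
           Γ ⊢ (inst φ u ∷ Δ) → Γ ⊢ (`∃ φ ∷ Δ)
    ∃L   : ∀ {Γ Δ} (φ : Formula Par 1) (a : ℕ) →
           FreshIn a (`∃ φ ∷ Γ) Δ →
           (inst φ (fv a) ∷ Γ) ⊢ Δ → (`∃ φ ∷ Γ) ⊢ Δ
    weak : ∀ {Γ Δ} Γ₁ Δ₁ → Γ ⊢ Δ → (Γ ++ Γ₁) ⊢ (Δ ++ Δ₁)
    cut  : ∀ {Γ Δ Γ₁ Δ₁} φ → Γ ⊢ (φ ∷ Δ) → (φ ∷ Γ₁) ⊢ Δ₁ → (Γ ++ Γ₁) ⊢ (Δ ++ Δ₁)
    set  : ∀ {Γ Δ Γ′ Δ′} → Γ ≈ₛ Γ′ → Δ ≈ₛ Δ′ → Γ ⊢ Δ → Γ′ ⊢ Δ′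

  -- Closed formulas of the extended language are  Formula M 0 : parameters
  -- are the names ū of elements u ∈ M (a constant c is identified with the
  -- name of its interpretation c̃), and there are no free bound variables.
  record QBModel : Set₁ where
    field
      M      : Set
      point  : M
      interp : Const → M
      vAtom  : (P : Pred) → Vec (Term M 0) (arity P) → Bool
      vImp   : Formula M 0 → Formula M 0 → Bool

    sat : ∀ {n} → (Fin n → M) → Formula M n → Set
    sat ρ (atom P ts) = vAtom P (substTs (λ i → par (ρ i)) ts) ≡ true
    sat ρ `⊤          = ⊤
    sat ρ (φ `∧ ψ)    = sat ρ φ × sat ρ ψ
    sat ρ (φ `∨ ψ)    = sat ρ φ ⊎ sat ρ ψ
    sat ρ (φ `→ ψ)    = vImp (substF (λ i → par (ρ i)) φ)
                             (substF (λ i → par (ρ i)) ψ) ≡ true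
    sat ρ (`∀ φ)      = ∀ (u : M) → sat (extend u ρ) φ
      where
        extend : ∀ {n} → M → (Fin n → M) → Fin (suc n) → M
        extend u ρ zero    = u
        extend u ρ (suc i) = ρ i
    sat ρ (`∃ φ)      = Σ M (λ u → sat (extend u ρ) φ)
      where
        extend : ∀ {n} → M → (Fin n → M) → Fin (suc n) → M
        extend u ρ zero    = u
        extend u ρ (suc i) = ρ i

    _⊨ : Formula M 0 → Set
    φ ⊨ = sat (λ ()) φ

  IsQuasiBoolean : QBModel → Set
  IsQuasiBoolean 𝓜 =
    ∀ (φ ψ : Formula M 0) →
      (ψ ⊨ → vImp φ ψ ≡ true) ×
      (vImp φ ψ ≡ true → (¬ (φ ⊨)) ⊎ (ψ ⊨))
    where open QBModel 𝓜

  Valid : QBModel → List Fm → List Fm → Set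
  Valid 𝓜 Γ Δ =
    ∀ (e : ℕ → M) →
      All (λ φ → (mapF (ι e) φ) ⊨) Γ → Any (λ φ → (mapF (ι e) φ) ⊨) Δ
    where
      open QBModel 𝓜
      ι : (ℕ → M) → Par → M
      ι e (inj₁ a) = e a
      ι e (inj₂ c) = interp c

-- Soundness is proved rule by rule, for the stronger notion of validity in
-- which the constants are interpreted arbitrarily too.  The implication rules
-- use exactly the quasi-boolean conditions: (→Rp) is condition (1), and (→L)
-- uses condition (2) as modus ponens.  (∀R) is the one classical step: to
-- conclude ∀φ ∨ ⋁Δ one splits on whether ⋁Δ holds, which is decidable since
-- condition (2) for ⊤ → χ makes v(⊤ → χ) decide χ.  The eigenvariable rules
-- are sound because reinterpreting the fresh variable leaves the rest of the
-- sequent untouched.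
module Submission where

open import Defs
open import Data.Bool using (true; false)
open import Data.Bool.Properties using (not-¬)
open import Data.Empty using (⊥-elim)
open import Data.Fin using (Fin; zero; suc)
open import Data.List using (List; []; _∷_)
open import Data.List.Relation.Binary.Subset.Propositional.Properties
  using (Any-resp-⊆; All-resp-⊇)
open import Data.List.Relation.Unary.All using (All; []; _∷_)
import Data.List.Relation.Unary.All.Properties as All
open import Data.List.Relation.Unary.Any using (Any; here; there; any?)
import Data.List.Relation.Unary.Any.Properties as Any
open import Data.Nat using (ℕ; suc; _≟_)
open import Data.Product using (_,_; proj₁; proj₂)
open import Data.Product.Function.NonDependent.Propositional using (_×-⇔_)
open import Data.Sum using (inj₁; inj₂; fromInj₂)
open import Data.Sum.Function.Propositional using (_⊎-⇔_)
open import Data.Unit using (tt)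
open import Data.Vec using (Vec; []; _∷_; toList)
open import Function using (_∘_; id; _⇔_; mk⇔; Equivalence)
open import Function.Related.Propositional using (≡⇒)
open import Relation.Nullary using (¬_; Dec; yes; no)
open import Relation.Binary.PropositionalEquality

open Equivalence using (to; from)

module _ (S : Signature) where
  open Logic S

  module _ {V : Set} where

    substT-wkT : ∀ {n k} (τ : Fin (suc n) → Term V k) (t : Term V n) →
                 substT τ (wkT t) ≡ substT (τ ∘ suc) t
    substT-wkT τ (bvar i) = refl
    substT-wkT τ (par v)  = refl

    liftσ-id : ∀ {n} {σ : Fin n → Term V n} → σ ≗ bvar → liftσ σ ≗ bvar
    liftσ-id σ≗ zero    = refl
    liftσ-id σ≗ (suc i) = cong wkT (σ≗ i)

    substTs-id : ∀ {n k} {σ : Fin n → Term V n} → σ ≗ bvar →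
                 (ts : Vec (Term V n) k) → substTs σ ts ≡ ts
    substTs-id σ≗ []            = refl
    substTs-id σ≗ (bvar i ∷ ts) = cong₂ _∷_ (σ≗ i) (substTs-id σ≗ ts)
    substTs-id σ≗ (par v  ∷ ts) = cong (par v ∷_) (substTs-id σ≗ ts)

    substF-id : ∀ {n} {σ : Fin n → Term V n} → σ ≗ bvar →
                (φ : Formula V n) → substF σ φ ≡ φ
    substF-id σ≗ (atom P ts) = cong (atom P) (substTs-id σ≗ ts)
    substF-id σ≗ `⊤          = refl
    substF-id σ≗ (φ `∧ ψ)    = cong₂ _`∧_ (substF-id σ≗ φ) (substF-id σ≗ ψ)
    substF-id σ≗ (φ `∨ ψ)    = cong₂ _`∨_ (substF-id σ≗ φ) (substF-id σ≗ ψ)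
    substF-id σ≗ (φ `→ ψ)    = cong₂ _`→_ (substF-id σ≗ φ) (substF-id σ≗ ψ)
    substF-id σ≗ (`∀ φ)      = cong `∀ (substF-id (liftσ-id σ≗) φ)
    substF-id σ≗ (`∃ φ)      = cong `∃ (substF-id (liftσ-id σ≗) φ)

    module _ {m n k} {σ : Fin m → Term V n} {τ : Fin n → Term V k}
             {ρ : Fin m → Term V k} where

      liftσ-∘ : substT τ ∘ σ ≗ ρ → substT (liftσ τ) ∘ liftσ σ ≗ liftσ ρ
      liftσ-∘ τσ≗ρ zero    = refl
      liftσ-∘ τσ≗ρ (suc i) = trans (substT-wkT (liftσ τ) (σ i))
                                   (trans (wkT-substT (σ i)) (cong wkT (τσ≗ρ i)))
        where
          wkT-substT : (t : Term V n) → substT (wkT ∘ τ) t ≡ wkT (substT τ t)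
          wkT-substT (bvar j) = refl
          wkT-substT (par v)  = refl

      substTs-∘ : substT τ ∘ σ ≗ ρ → ∀ {j} (ts : Vec (Term V m) j) →
                  substTs τ (substTs σ ts) ≡ substTs ρ ts
      substTs-∘ τσ≗ρ []            = refl
      substTs-∘ τσ≗ρ (bvar i ∷ ts) = cong₂ _∷_ (τσ≗ρ i) (substTs-∘ τσ≗ρ ts)
      substTs-∘ τσ≗ρ (par v  ∷ ts) = cong (par v ∷_) (substTs-∘ τσ≗ρ ts)

    substF-∘ : ∀ {m n k} {σ : Fin m → Term V n} {τ : Fin n → Term V k}
               {ρ : Fin m → Term V k} → substT τ ∘ σ ≗ ρ →
               (φ : Formula V m) → substF τ (substF σ φ) ≡ substF ρ φ
    substF-∘ τσ≗ρ (atom P ts) = cong (atom P) (substTs-∘ τσ≗ρ ts)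
    substF-∘ τσ≗ρ `⊤          = refl
    substF-∘ τσ≗ρ (φ `∧ ψ)    = cong₂ _`∧_ (substF-∘ τσ≗ρ φ) (substF-∘ τσ≗ρ ψ)
    substF-∘ τσ≗ρ (φ `∨ ψ)    = cong₂ _`∨_ (substF-∘ τσ≗ρ φ) (substF-∘ τσ≗ρ ψ)
    substF-∘ τσ≗ρ (φ `→ ψ)    = cong₂ _`→_ (substF-∘ τσ≗ρ φ) (substF-∘ τσ≗ρ ψ)
    substF-∘ τσ≗ρ (`∀ φ)      = cong `∀ (substF-∘ (liftσ-∘ τσ≗ρ) φ)
    substF-∘ τσ≗ρ (`∃ φ)      = cong `∃ (substF-∘ (liftσ-∘ τσ≗ρ) φ)

  module _ {V W : Set} (g : V → W) where

    module _ {m n} {σ : Fin m → Term V n} {τ : Fin m → Term W n} where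

      liftσ-mapT : mapT g ∘ σ ≗ τ → mapT g ∘ liftσ σ ≗ liftσ τ
      liftσ-mapT gσ≗τ zero    = refl
      liftσ-mapT gσ≗τ (suc i) = trans (mapT-wkT (σ i)) (cong wkT (gσ≗τ i))
        where
          mapT-wkT : ∀ {l} (t : Term V l) → mapT g (wkT t) ≡ wkT (mapT g t)
          mapT-wkT (bvar j) = refl
          mapT-wkT (par v)  = refl

      mapTs-substTs : mapT g ∘ σ ≗ τ → ∀ {k} (ts : Vec (Term V m) k) →
                      mapTs g (substTs σ ts) ≡ substTs τ (mapTs g ts)
      mapTs-substTs gσ≗τ []            = refl
      mapTs-substTs gσ≗τ (bvar i ∷ ts) = cong₂ _∷_ (gσ≗τ i) (mapTs-substTs gσ≗τ ts)
      mapTs-substTs gσ≗τ (par v  ∷ ts) = cong (par (g v) ∷_) (mapTs-substTs gσ≗τ ts)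

    mapF-substF : ∀ {m n} {σ : Fin m → Term V n} {τ : Fin m → Term W n} →
                  mapT g ∘ σ ≗ τ → (φ : Formula V m) →
                  mapF g (substF σ φ) ≡ substF τ (mapF g φ)
    mapF-substF gσ≗τ (atom P ts) = cong (atom P) (mapTs-substTs gσ≗τ ts)
    mapF-substF gσ≗τ `⊤          = refl
    mapF-substF gσ≗τ (φ `∧ ψ)    = cong₂ _`∧_ (mapF-substF gσ≗τ φ) (mapF-substF gσ≗τ ψ)
    mapF-substF gσ≗τ (φ `∨ ψ)    = cong₂ _`∨_ (mapF-substF gσ≗τ φ) (mapF-substF gσ≗τ ψ)
    mapF-substF gσ≗τ (φ `→ ψ)    = cong₂ _`→_ (mapF-substF gσ≗τ φ) (mapF-substF gσ≗τ ψ)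
    mapF-substF gσ≗τ (`∀ φ)      = cong `∀ (mapF-substF (liftσ-mapT gσ≗τ) φ)
    mapF-substF gσ≗τ (`∃ φ)      = cong `∃ (mapF-substF (liftσ-mapT gσ≗τ) φ)

    mapF-inst : (φ : Formula V 1) (u : V) → mapF g (inst φ u) ≡ inst (mapF g φ) (g u)
    mapF-inst φ u = mapF-substF (λ _ → refl) φ

  module _ {W : Set} {a : ℕ} {f g : Par → W}
           (f≈g : ∀ u → u ≢ fv a → f u ≡ g u) where

    mapTs-fresh : ∀ {n k} (ts : Vec (Term Par n) k) →
                  ¬ Any (OccT a) (toList ts) → mapTs f ts ≡ mapTs g ts
    mapTs-fresh []            _    = refl
    mapTs-fresh (bvar i ∷ ts) ¬occ = cong (bvar i ∷_) (mapTs-fresh ts (¬occ ∘ there))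
    mapTs-fresh (par u  ∷ ts) ¬occ =
      cong₂ _∷_ (cong par (f≈g u (¬occ ∘ here))) (mapTs-fresh ts (¬occ ∘ there))

    mapF-fresh : ∀ {n} (φ : Formula Par n) → ¬ OccF a φ → mapF f φ ≡ mapF g φ
    mapF-fresh (atom P ts) ¬occ = cong (atom P) (mapTs-fresh ts ¬occ)
    mapF-fresh `⊤          ¬occ = refl
    mapF-fresh (φ `∧ ψ)    ¬occ = cong₂ _`∧_ (mapF-fresh φ (¬occ ∘ inj₁)) (mapF-fresh ψ (¬occ ∘ inj₂))
    mapF-fresh (φ `∨ ψ)    ¬occ = cong₂ _`∨_ (mapF-fresh φ (¬occ ∘ inj₁)) (mapF-fresh ψ (¬occ ∘ inj₂))
    mapF-fresh (φ `→ ψ)    ¬occ = cong₂ _`→_ (mapF-fresh φ (¬occ ∘ inj₁)) (mapF-fresh ψ (¬occ ∘ inj₂))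
    mapF-fresh (`∀ φ)      ¬occ = cong `∀ (mapF-fresh φ ¬occ)
    mapF-fresh (`∃ φ)      ¬occ = cong `∃ (mapF-fresh φ ¬occ)

  module _ {W : Set} where

    update : (Par → W) → ℕ → W → Par → W
    update f a w (inj₁ b) with b ≟ a
    ... | yes _ = w
    ... | no  _ = f (inj₁ b)
    update f a w (inj₂ c) = f (inj₂ c)

    update-same : ∀ f a w → update f a w (fv a) ≡ w
    update-same f a w with a ≟ a
    ... | yes _   = refl
    ... | no  a≢a = ⊥-elim (a≢a refl)

    update-other : ∀ f a w u → u ≢ fv a → update f a w u ≡ f u
    update-other f a w (inj₁ b) b≢a with b ≟ a
    ... | yes refl = ⊥-elim (b≢a refl)
    ... | no  _    = refl
    update-other f a w (inj₂ c) _ = refl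

    mapF-update-fresh : ∀ {n} f a w (φ : Formula Par n) → ¬ OccF a φ →
                        mapF (update f a w) φ ≡ mapF f φ
    mapF-update-fresh f a w = mapF-fresh (update-other f a w)

    mapF-update-inst : ∀ f a w (φ : Formula Par 1) → ¬ OccF a φ →
                       mapF (update f a w) (inst φ (fv a)) ≡ inst (mapF f φ) w
    mapF-update-inst f a w φ ¬occ = begin
      mapF (update f a w) (inst φ (fv a))               ≡⟨ mapF-inst (update f a w) φ (fv a) ⟩
      inst (mapF (update f a w) φ) (update f a w (fv a)) ≡⟨ cong₂ inst (mapF-update-fresh f a w φ ¬occ)
                                                                      (update-same f a w) ⟩
      inst (mapF f φ) w                                  ∎
      where open ≡-Reasoning

  module Semantics (𝓜 : QBModel) where
    open QBModel 𝓜

    names : ∀ {n} → (Fin n → M) → Fin n → Term M 0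
    names ρ i = par (ρ i)

    -- The environments in the quantifier clauses of sat are local to Defs,
    -- so they are described only by how they act on zero and suc.
    lift-env : ∀ {m n} {σ : Fin m → Term M n} {g : Fin (suc n) → M} {g′ : Fin (suc m) → M} →
               substT (names (g ∘ suc)) ∘ σ ≗ par ∘ g′ ∘ suc → g zero ≡ g′ zero →
               substT (names g) ∘ liftσ σ ≗ par ∘ g′
    lift-env σ≗ g₀ zero = cong par g₀
    lift-env {σ = σ} {g} σ≗ g₀ (suc i) = trans (substT-wkT (names g) (σ i)) (σ≗ i)

    sat-substF : ∀ {m n} (σ : Fin m → Term M n) (ρ : Fin n → M) (ρ′ : Fin m → M) →
                 substT (names ρ) ∘ σ ≗ par ∘ ρ′ →
                 (φ : Formula M m) → sat ρ (substF σ φ) ⇔ sat ρ′ φ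
    sat-substF σ ρ ρ′ σρ≗ρ′ (atom P ts) =
      ≡⇒ (cong (λ us → vAtom P us ≡ true) (substTs-∘ σρ≗ρ′ ts))
    sat-substF σ ρ ρ′ σρ≗ρ′ `⊤       = mk⇔ id id
    sat-substF σ ρ ρ′ σρ≗ρ′ (φ `∧ ψ) = sat-substF σ ρ ρ′ σρ≗ρ′ φ ×-⇔ sat-substF σ ρ ρ′ σρ≗ρ′ ψ
    sat-substF σ ρ ρ′ σρ≗ρ′ (φ `∨ ψ) = sat-substF σ ρ ρ′ σρ≗ρ′ φ ⊎-⇔ sat-substF σ ρ ρ′ σρ≗ρ′ ψ
    sat-substF σ ρ ρ′ σρ≗ρ′ (φ `→ ψ) =
      ≡⇒ (cong₂ (λ χ ξ → vImp χ ξ ≡ true) (substF-∘ σρ≗ρ′ φ) (substF-∘ σρ≗ρ′ ψ))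
    sat-substF σ ρ ρ′ σρ≗ρ′ (`∀ φ) =
      mk⇔ (λ s u → to   (sat-substF (liftσ σ) _ _ (lift-env σρ≗ρ′ refl) φ) (s u))
          (λ s u → from (sat-substF (liftσ σ) _ _ (lift-env σρ≗ρ′ refl) φ) (s u))
    sat-substF σ ρ ρ′ σρ≗ρ′ (`∃ φ) =
      mk⇔ (λ (u , s) → u , to   (sat-substF (liftσ σ) _ _ (lift-env σρ≗ρ′ refl) φ) s)
          (λ (u , s) → u , from (sat-substF (liftσ σ) _ _ (lift-env σρ≗ρ′ refl) φ) s)

    sat-inst : (φ : Formula M 1) (g : Fin 1 → M) → inst φ (g zero) ⊨ ⇔ sat g φ
    sat-inst φ g = sat-substF _ (λ ()) g (λ { zero → refl }) φ

    ⊨-→ : (φ ψ : Formula M 0) → (φ `→ ψ) ⊨ ≡ (vImp φ ψ ≡ true)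
    ⊨-→ φ ψ = cong₂ (λ χ ξ → vImp χ ξ ≡ true) (substF-id (λ ()) φ) (substF-id (λ ()) ψ)

    Holds : (Par → M) → Fm → Set
    Holds f φ = mapF f φ ⊨

    Valid∀ : List Fm → List Fm → Set
    Valid∀ Γ Δ = ∀ f → All (Holds f) Γ → Any (Holds f) Δ

    module _ {f : Par → M} {a : ℕ} {w : M} where

      All-update : ∀ {Γ} → ¬ Any (OccF a) Γ → All (Holds f) Γ → All (Holds (update f a w)) Γ
      All-update {[]}    fresh []       = []
      All-update {φ ∷ Γ} fresh (h ∷ hs) =
        subst _⊨ (sym (mapF-update-fresh f a w φ (fresh ∘ here))) h ∷ All-update (fresh ∘ there) hs

      Any-update⁻ : ∀ {Δ} → ¬ Any (OccF a) Δ → Any (Holds (update f a w)) Δ → Any (Holds f) Δ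
      Any-update⁻ {φ ∷ Δ} fresh (here h)  = here (subst _⊨ (mapF-update-fresh f a w φ (fresh ∘ here)) h)
      Any-update⁻ {φ ∷ Δ} fresh (there h) = there (Any-update⁻ (fresh ∘ there) h)

    ∃L-sound : ∀ {Γ Δ} φ a → FreshIn a (`∃ φ ∷ Γ) Δ →
               Valid∀ (inst φ (fv a) ∷ Γ) Δ → Valid∀ (`∃ φ ∷ Γ) Δ
    ∃L-sound φ a (fresh∃Γ , freshΔ) premise f ((w , s) ∷ hs) =
      Any-update⁻ freshΔ (premise (update f a w) (witness ∷ All-update (fresh∃Γ ∘ there) hs))
      where
        witness : Holds (update f a w) (inst φ (fv a))
        witness = subst _⊨ (sym (mapF-update-inst f a w φ (fresh∃Γ ∘ here)))
                           (from (sat-inst (mapF f φ) _) s)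

    module QuasiBoolean (qb : IsQuasiBoolean 𝓜) where

      ⊨-→-intro : (φ ψ : Formula M 0) → ψ ⊨ → (φ `→ ψ) ⊨
      ⊨-→-intro φ ψ ψ⊨ = subst id (sym (⊨-→ φ ψ)) (proj₁ (qb φ ψ) ψ⊨)

      ⊨-→-elim : (φ ψ : Formula M 0) → (φ `→ ψ) ⊨ → φ ⊨ → ψ ⊨
      ⊨-→-elim φ ψ φ→ψ⊨ φ⊨ =
        fromInj₂ (λ φ⊭ → ⊥-elim (φ⊭ φ⊨)) (proj₂ (qb φ ψ) (subst id (⊨-→ φ ψ) φ→ψ⊨))

      ⊨? : (χ : Formula M 0) → Dec (χ ⊨)
      ⊨? χ with vImp `⊤ χ in v⊤→χ
      ... | true  = yes (fromInj₂ (λ ⊤⊭ → ⊥-elim (⊤⊭ tt)) (proj₂ (qb `⊤ χ) v⊤→χ))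
      ... | false = no (λ χ⊨ → not-¬ refl (trans (sym v⊤→χ) (proj₁ (qb `⊤ χ) χ⊨)))

      ∀R-sound : ∀ {Γ Δ} φ a → FreshIn a Γ (`∀ φ ∷ Δ) →
                 Valid∀ Γ (inst φ (fv a) ∷ Δ) → Valid∀ Γ (`∀ φ ∷ Δ)
      ∀R-sound {Δ = Δ} φ a (freshΓ , fresh∀Δ) premise f hs with any? (⊨? ∘ mapF f) Δ
      ... | yes δ = there δ
      ... | no ¬δ = here (λ w → to (sat-inst (mapF f φ) _) (at w))
        where
          at : ∀ w → inst (mapF f φ) w ⊨
          at w with premise (update f a w) (All-update freshΓ hs)
          ... | here h  = subst _⊨ (mapF-update-inst f a w φ (fresh∀Δ ∘ here)) h
          ... | there δ = ⊥-elim (¬δ (Any-update⁻ (fresh∀Δ ∘ there) δ))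

      sound : ∀ {Γ Δ} → Γ ⊢ Δ → Valid∀ Γ Δ
      sound (ax φ)            f (h ∷ [])       = here h
      sound ax⊤               f _              = here tt
      sound (∧L d)            f ((h , k) ∷ hs) = sound d f (h ∷ k ∷ hs)
      sound (∧R d e)          f hs with sound d f hs | sound e f hs
      ... | here h  | here k  = here (h , k)
      ... | there δ | _       = there δ
      ... | here _  | there δ = there δ
      sound (∨L d e)          f (inj₁ h ∷ hs)  = sound d f (h ∷ hs)
      sound (∨L d e)          f (inj₂ k ∷ hs)  = sound e f (k ∷ hs)
      sound (∨R d)            f hs with sound d f hs
      ... | here h          = here (inj₁ h)
      ... | there (here k)  = here (inj₂ k)
      ... | there (there δ) = there δ
      sound (→L d e)          f (φ→ψ ∷ hs) with sound e f hs
      ... | here φ  = sound d f (⊨-→-elim _ _ φ→ψ φ ∷ hs)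
      ... | there δ = δ
      sound (→Rp d)           f hs with sound d f hs
      ... | here ψ  = here (⊨-→-intro _ _ ψ)
      ... | there δ = there δ
      sound (∀R φ a fresh d)  = ∀R-sound φ a fresh (sound d)
      sound (∀L φ u d)        f (∀φ ∷ hs) =
        sound d f (subst _⊨ (sym (mapF-inst f φ u)) (from (sat-inst (mapF f φ) _) (∀φ (f u))) ∷ hs)
      sound (∃R φ u d)        f hs with sound d f hs
      ... | here h  = here (f u , to (sat-inst (mapF f φ) _) (subst _⊨ (mapF-inst f φ u) h))
      ... | there δ = there δ
      sound (∃L φ a fresh d)  = ∃L-sound φ a fresh (sound d)
      sound (weak {Γ} _ _ d)  f hs = Any.++⁺ˡ (sound d f (All.++⁻ˡ Γ hs))
      sound (cut {Γ} {Δ} φ d e) f hs with sound d f (All.++⁻ˡ Γ hs)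
      ... | here h  = Any.++⁺ʳ Δ (sound e f (h ∷ All.++⁻ʳ Γ hs))
      ... | there δ = Any.++⁺ˡ δ
      sound (set (Γ⊆Γ′ , _) (Δ⊆Δ′ , _) d) f hs = Any-resp-⊆ Δ⊆Δ′ (sound d f (All-resp-⊇ Γ⊆Γ′ hs))

theorem5 : (S : Signature) → (Γ Δ : List (Logic.Fm S)) →
    Logic._⊢_ S Γ Δ →
    (𝓜 : Logic.QBModel S) → Logic.IsQuasiBoolean S 𝓜 →
    Logic.Valid S 𝓜 Γ Δ
theorem5 S Γ Δ d 𝓜 qb e = Semantics.QuasiBoolean.sound S 𝓜 qb d _
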